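{- For any matroid $M$ with $|E(M)|\geq 2$ and any element $e\in E(M)$, $\kappa(M)-1\leq\kappa(M\setminus e)$.
   Context: For a matroid $M$ with rank function $r$ and $X\subseteq E(M)$, write $\overline{X}=E(M)-X$ and $\lambda_M(X)=r(X)+r(\overline{X})-r(M)$. A vertical $k$-separation ($k\in\mathbb{N}$) is a pair $(X,\overline{X})$ with $r(X)\geq k$, $r(\overline{X})\geq k$ and $\lambda_M(X)<k$. The vertical connectivity $\kappa(M)$ is the least $k$ such that $M$ has a vertical $k$-separation if one exists (equivalently, if $E(M)$ is the union of two proper flats), and $\kappa(M)=r(M)$ otherwise. -}

module Defs where

open import Data.Nat using (ℕ; zero; suc; _+_; _∸_; _≤_; _<_; _≤?_; _<?_)
open import Data.Fin using (Fin)
open import Data.Fin.Subset using (Subset; _⊆_; _∩_; _∪_; _─_; _-_; ∣_∣)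
open import Data.Fin.Subset.Properties using (_⊆?_; anySubset?; ⊆-trans; p─q⊆p)
open import Data.Product using (_×_; Σ; ∃)
open import Relation.Nullary using (Dec; yes; no; _×-dec_)

-- A (finite) matroid whose ground set E is a subset of Fin n, given by its
-- rank function r (values on subsets of E are what matter), satisfying the
-- standard rank axioms (R1)-(R3) on subsets of E.
record Matroid (n : ℕ) : Set where
  field
    E          : Subset n
    r          : Subset n → ℕ
    r-bound    : ∀ X → X ⊆ E → r X ≤ ∣ X ∣
    r-mono     : ∀ X Y → X ⊆ E → Y ⊆ E → X ⊆ Y → r X ≤ r Y
    r-submod   : ∀ X Y → X ⊆ E → Y ⊆ E → r (X ∪ Y) + r (X ∩ Y) ≤ r X + r Y

open Matroid public

_∖_ : ∀ {n} → Matroid n → Fin n → Matroid n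
_∖_ {n} M e = record
  { E        = E M - e
  ; r        = r M
  ; r-bound  = λ X X⊆ → r-bound M X (sub X⊆)
  ; r-mono   = λ X Y X⊆ Y⊆ X⊆Y → r-mono M X Y (sub X⊆) (sub Y⊆) X⊆Y
  ; r-submod = λ X Y X⊆ Y⊆ → r-submod M X Y (sub X⊆) (sub Y⊆)
  }
  where
  sub : ∀ {X : Subset n} → X ⊆ E M - e → X ⊆ E M
  sub X⊆ = ⊆-trans X⊆ (p─q⊆p (E M) _)

module _ {n : ℕ} (M : Matroid n) where

  compl : Subset n → Subset n
  compl X = E M ─ X

  rM : ℕ
  rM = r M (E M)

  -- λ_M(X) = r(X) + r(X̄) - r(M)   (never truncated, by submodularity)
  λM : Subset n → ℕ
  λM X = r M X + r M (compl X) ∸ rM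

  IsVerticalSep : ℕ → Subset n → Set
  IsVerticalSep k X = X ⊆ E M × k ≤ r M X × k ≤ r M (compl X) × λM X < k

  isVerticalSep? : ∀ k X → Dec (IsVerticalSep k X)
  isVerticalSep? k X =
    (X ⊆? E M) ×-dec ((k ≤? r M X) ×-dec ((k ≤? r M (compl X)) ×-dec (λM X <? k)))

  HasVerticalSep : ℕ → Set
  HasVerticalSep k = ∃ λ X → IsVerticalSep k X

  hasVerticalSep? : ∀ k → Dec (HasVerticalSep k)
  hasVerticalSep? k = anySubset? (isVerticalSep? k)

  κ-search : ℕ → ℕ → ℕ
  κ-search k zero = rM
  κ-search k (suc fuel) with hasVerticalSep? k
  ... | yes _ = k
  ... | no  _ = κ-search (suc k) fuel

  -- Vertical connectivity κ(M).  A vertical k-separation needs k ≥ 1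
  -- (since λ ≥ 0) and k ≤ r(X) ≤ r(M), so testing k = 1, ..., r(M) suffices.
  κ : ℕ
  κ = κ-search 1 rM

{-# OPTIONS --safe #-}
-- If κ(M \ e) = r(M \ e), then κ(M) ≤ r(M) ≤ r(M \ e) + 1. Otherwise let (X, Y) be a
-- vertical k-separation of M \ e with k = κ(M \ e). Adding e to X, to Y, or to the whole
-- ground set raises the rank by at most one. If r(M) = r(M \ e) + 1, or if e lies in the
-- closure of X or of Y, one of (X ∪ e, Y), (X, Y ∪ e) is still a vertical k-separation of M.
-- Otherwise both ranks grow, so λ increases by exactly one: the separation is a vertical
-- (k + 1)-separation as soon as one side of (X, Y) has rank above k, and if both have rank k
-- then either r(M) ≤ k + 1 or λ_M(X ∪ e) < k.
module Submission where

open import Defs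
open import Data.Nat using (ℕ; suc; _+_; _∸_; _≤_; _<_; z<s; s≤s; s≤s⁻¹; _≤?_; >-nonZero)
open import Data.Nat.Properties hiding (_≟_)
open import Data.Fin using (Fin; _≟_)
open import Data.Fin.Subset using (Subset; _⊆_; _∪_; _∩_; _─_; _-_; ⁅_⁆; _∈_; ∣_∣)
open import Data.Fin.Subset.Properties
open import Data.Product using (_×_; _,_; ∃-syntax)
open import Data.Sum using (_⊎_; inj₁; inj₂)
open import Data.Empty using (⊥-elim)
open import Relation.Nullary using (yes; no)
open import Relation.Binary.PropositionalEquality using (_≡_; refl; sym; trans; cong; subst; subst₂)

-- The ranks a = r(Z), b = r(E - Z), R = r(M) of a vertical j-separation (Z, E - Z),
-- with λ(Z) < j stated without truncated subtraction.
VerticalSepRanks : ℕ → ℕ → ℕ → ℕ → Set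
VerticalSepRanks a b R j = 0 < j × j ≤ a × j ≤ b × a + b < R + j

m≤n≤1+m⇒n≡m∨n≡1+m : ∀ {m n} → m ≤ n → n ≤ suc m → n ≡ m ⊎ n ≡ suc m
m≤n≤1+m⇒n≡m∨n≡1+m m≤n n≤1+m with m≤n⇒m<n∨m≡n m≤n
... | inj₁ m<n = inj₂ (≤-antisym n≤1+m m<n)
... | inj₂ m≡n = inj₁ (sym m≡n)

-- a and b are the ranks of the sides X, Y of a vertical k-separation of M \ e and
-- R⁻ = r(M \ e); a⁺ = r(X ∪ e), b⁺ = r(Y ∪ e) and R = r(M).
deletion-sepRanks : ∀ {a a⁺ b b⁺ R⁻ R k} →
  a ≤ a⁺ → a⁺ ≤ suc a → b ≤ b⁺ → b⁺ ≤ suc b → R⁻ ≤ R → R ≤ suc R⁻ →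
  VerticalSepRanks a b R⁻ k →
  (∃[ j ] j ≤ suc k × (VerticalSepRanks a⁺ b R j ⊎ VerticalSepRanks a b⁺ R j)) ⊎ R ≤ suc k
deletion-sepRanks {a} {a⁺} {b} {b⁺} {R⁻} {R} {k}
  a≤a⁺ a⁺≤1+a b≤b⁺ b⁺≤1+b R⁻≤R R≤1+R⁻ (0<k , k≤a , k≤b , a+b<R⁻+k)
  with m≤n≤1+m⇒n≡m∨n≡1+m R⁻≤R R≤1+R⁻
... | inj₂ refl =
  inj₁ (k , n≤1+n k , inj₁ (0<k , ≤-trans k≤a a≤a⁺ , k≤b ,
    ≤-<-trans (+-monoˡ-≤ b a⁺≤1+a) (s≤s a+b<R⁻+k)))
... | inj₁ refl with m≤n≤1+m⇒n≡m∨n≡1+m a≤a⁺ a⁺≤1+a | m≤n≤1+m⇒n≡m∨n≡1+m b≤b⁺ b⁺≤1+b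
... | inj₁ refl | _         = inj₁ (k , n≤1+n k , inj₁ (0<k , k≤a , k≤b , a+b<R⁻+k))
... | inj₂ refl | inj₁ refl = inj₁ (k , n≤1+n k , inj₂ (0<k , k≤a , k≤b , a+b<R⁻+k))
... | inj₂ refl | inj₂ refl with suc k ≤? b | suc k ≤? a
...   | yes 1+k≤b | _ =
  inj₁ (suc k , ≤-refl , inj₁ (z<s , s≤s k≤a , 1+k≤b ,
    subst (suc (a + b) <_) (sym (+-suc R k)) (s≤s a+b<R⁻+k)))
...   | no _ | yes 1+k≤a =
  inj₁ (suc k , ≤-refl , inj₂ (z<s , 1+k≤a , s≤s k≤b ,
    subst₂ _<_ (sym (+-suc a b)) (sym (+-suc R k)) (s≤s a+b<R⁻+k)))
...   | no 1+k≰b | no 1+k≰a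
  with ≤-antisym (s≤s⁻¹ (≰⇒> 1+k≰a)) k≤a | ≤-antisym (s≤s⁻¹ (≰⇒> 1+k≰b)) k≤b
...   | refl | refl with R ≤? suc k
...     | yes R≤1+k = inj₂ R≤1+k
...     | no R≰1+k =
  inj₁ (k , n≤1+n k , inj₁ (0<k , n≤1+n k , ≤-refl , +-monoˡ-< k (≰⇒> R≰1+k)))

∪-least : ∀ {n} {p q r : Subset n} → p ⊆ r → q ⊆ r → p ∪ q ⊆ r
∪-least {p = p} {q} p⊆r q⊆r x∈p∪q with x∈p∪q⁻ p q x∈p∪q
... | inj₁ x∈p = p⊆r x∈p
... | inj₂ x∈q = q⊆r x∈q

x∈p⇒⁅x⁆⊆p : ∀ {n} {p : Subset n} {x} → x ∈ p → ⁅ x ⁆ ⊆ p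
x∈p⇒⁅x⁆⊆p {x = x} x∈p y∈⁅x⁆ = subst (_∈ _) (sym (x∈⁅y⁆⇒x≡y x y∈⁅x⁆)) x∈p

p⊆p-x∪⁅x⁆ : ∀ {n} (p : Subset n) x → p ⊆ (p - x) ∪ ⁅ x ⁆
p⊆p-x∪⁅x⁆ p x {y} y∈p with y ≟ x
... | yes refl = x∈p∪q⁺ (inj₂ (x∈⁅x⁆ y))
... | no y≢x = x∈p∪q⁺ (inj₁ (x∈p∧x≢y⇒x∈p-y y∈p y≢x))

module _ {n : ℕ} (M : Matroid n) where

  κ-search-≤ : ∀ s f {k} → s ≤ k → k < s + f → HasVerticalSep M k → κ-search M s f ≤ k
  κ-search-≤ s 0 {k} s≤k k<s+0 _ =
    ⊥-elim (<-irrefl refl (≤-<-trans s≤k (subst (k <_) (+-identityʳ s) k<s+0)))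
  κ-search-≤ s (suc f) {k} s≤k k<s+1+f sep with hasVerticalSep? M s
  ... | yes _ = s≤k
  ... | no ¬sep with m≤n⇒m<n∨m≡n s≤k
  ...   | inj₂ refl = ⊥-elim (¬sep sep)
  ...   | inj₁ s<k = κ-search-≤ (suc s) f s<k (subst (k <_) (+-suc s f) k<s+1+f) sep

  κ-search≤rM : ∀ s f → s + f ≤ suc (rM M) → κ-search M s f ≤ rM M
  κ-search≤rM s 0 _ = ≤-refl
  κ-search≤rM s (suc f) s+1+f≤1+R with hasVerticalSep? M s
  ... | yes _ = s≤s⁻¹ (≤-trans (s≤s (m≤m+n s f)) (subst (_≤ suc (rM M)) (+-suc s f) s+1+f≤1+R))
  ... | no _ = κ-search≤rM (suc s) f (subst (_≤ suc (rM M)) (+-suc s f) s+1+f≤1+R)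

  κ-search≡rM⊎sep : ∀ s f → κ-search M s f ≡ rM M ⊎ HasVerticalSep M (κ-search M s f)
  κ-search≡rM⊎sep s 0 = inj₁ refl
  κ-search≡rM⊎sep s (suc f) with hasVerticalSep? M s
  ... | yes sep = inj₂ sep
  ... | no _ = κ-search≡rM⊎sep (suc s) f

  κ≤rM : κ M ≤ rM M
  κ≤rM = κ-search≤rM 1 (rM M) ≤-refl

  κ≡rM⊎sep : κ M ≡ rM M ⊎ HasVerticalSep M (κ M)
  κ≡rM⊎sep = κ-search≡rM⊎sep 1 (rM M)

  isVerticalSep⇒sepRanks : ∀ {j Z} → IsVerticalSep M j Z →
                           VerticalSepRanks (r M Z) (r M (compl M Z)) (rM M) j
  isVerticalSep⇒sepRanks {Z = Z} (_ , j≤a , j≤b , λ<j) =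
    m<n⇒0<n λ<j , j≤a , j≤b , ≤-<-trans (m≤n+m∸n a+b (rM M)) (+-monoʳ-< (rM M) λ<j)
    where a+b = r M Z + r M (compl M Z)

  sepRanks⇒isVerticalSep : ∀ {j Z} → Z ⊆ E M →
                           VerticalSepRanks (r M Z) (r M (compl M Z)) (rM M) j → IsVerticalSep M j Z
  sepRanks⇒isVerticalSep Z⊆E (0<j , j≤a , j≤b , a+b<R+j) =
    Z⊆E , j≤a , j≤b , m<n+o⇒m∸n<o _ (rM M) {{>-nonZero 0<j}} a+b<R+j

  hasVerticalSep⇒κ≤ : ∀ {j} → HasVerticalSep M j → κ M ≤ j
  hasVerticalSep⇒κ≤ sep@(Z , Z⊆E , j≤rZ , _ , λ<j) =
    κ-search-≤ 1 (rM M) (m<n⇒0<n λ<j) (s≤s (≤-trans j≤rZ (r-mono M Z (E M) Z⊆E ⊆-refl Z⊆E))) sep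

  r[p∪⁅x⁆]≤1+r[p] : ∀ {Z e} → Z ⊆ E M → e ∈ E M → r M (Z ∪ ⁅ e ⁆) ≤ suc (r M Z)
  r[p∪⁅x⁆]≤1+r[p] {Z} {e} Z⊆E e∈E = begin
    r M (Z ∪ ⁅ e ⁆)                    ≤⟨ m≤m+n _ _ ⟩
    r M (Z ∪ ⁅ e ⁆) + r M (Z ∩ ⁅ e ⁆)  ≤⟨ r-submod M Z ⁅ e ⁆ Z⊆E ⁅e⁆⊆E ⟩
    r M Z + r M ⁅ e ⁆                  ≤⟨ +-monoʳ-≤ (r M Z) r⁅e⁆≤1 ⟩
    r M Z + 1                          ≡⟨ +-comm (r M Z) 1 ⟩
    suc (r M Z)                        ∎
    where
    open ≤-Reasoning
    ⁅e⁆⊆E : ⁅ e ⁆ ⊆ E M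
    ⁅e⁆⊆E = x∈p⇒⁅x⁆⊆p e∈E
    r⁅e⁆≤1 : r M ⁅ e ⁆ ≤ 1
    r⁅e⁆≤1 = subst (r M ⁅ e ⁆ ≤_) (∣⁅x⁆∣≡1 e) (r-bound M ⁅ e ⁆ ⁅e⁆⊆E)

  r[p]≤r[p∪⁅x⁆] : ∀ {Z e} → Z ⊆ E M → e ∈ E M → r M Z ≤ r M (Z ∪ ⁅ e ⁆)
  r[p]≤r[p∪⁅x⁆] {Z} {e} Z⊆E e∈E =
    r-mono M Z (Z ∪ ⁅ e ⁆) Z⊆E (∪-least Z⊆E (x∈p⇒⁅x⁆⊆p e∈E)) (p⊆p∪q ⁅ e ⁆)

  r[p-x]≤r[p] : ∀ {Z} e → Z ⊆ E M → r M (Z - e) ≤ r M Z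
  r[p-x]≤r[p] {Z} e Z⊆E = r-mono M (Z - e) Z (⊆-trans (p─q⊆p Z ⁅ e ⁆) Z⊆E) Z⊆E (p─q⊆p Z ⁅ e ⁆)

  r[p]≤1+r[p-x] : ∀ {Z e} → Z ⊆ E M → e ∈ E M → r M Z ≤ suc (r M (Z - e))
  r[p]≤1+r[p-x] {Z} {e} Z⊆E e∈E =
    ≤-trans (r-mono M Z ((Z - e) ∪ ⁅ e ⁆) Z⊆E Z-e∪e⊆E (p⊆p-x∪⁅x⁆ Z e)) (r[p∪⁅x⁆]≤1+r[p] Z-e⊆E e∈E)
    where
    Z-e⊆E : Z - e ⊆ E M
    Z-e⊆E = ⊆-trans (p─q⊆p Z ⁅ e ⁆) Z⊆E
    Z-e∪e⊆E : (Z - e) ∪ ⁅ e ⁆ ⊆ E M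
    Z-e∪e⊆E = ∪-least Z-e⊆E (x∈p⇒⁅x⁆⊆p e∈E)

module _ {n : ℕ} (M : Matroid n) {e : Fin n} (e∈E : e ∈ E M) where

  compl[X∪⁅e⁆]≡compl∖ : ∀ X → compl M (X ∪ ⁅ e ⁆) ≡ compl (M ∖ e) X
  compl[X∪⁅e⁆]≡compl∖ X = trans (cong (E M ─_) (∪-comm X ⁅ e ⁆)) (sym (p─q─r≡p─q∪r (E M) ⁅ e ⁆ X))

  compl[X]-e≡compl∖ : ∀ X → compl M X - e ≡ compl (M ∖ e) X
  compl[X]-e≡compl∖ X = p─q─r≡p─r─q (E M) X ⁅ e ⁆

  r[compl∖]≤r[compl] : ∀ X → r M (compl (M ∖ e) X) ≤ r M (compl M X)
  r[compl∖]≤r[compl] X =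
    subst (λ Y → r M Y ≤ r M (compl M X)) (compl[X]-e≡compl∖ X) (r[p-x]≤r[p] M e (p─q⊆p (E M) X))

  r[compl]≤1+r[compl∖] : ∀ X → r M (compl M X) ≤ suc (r M (compl (M ∖ e) X))
  r[compl]≤1+r[compl∖] X =
    subst (λ Y → r M (compl M X) ≤ suc (r M Y)) (compl[X]-e≡compl∖ X)
      (r[p]≤1+r[p-x] M (p─q⊆p (E M) X) e∈E)

  deletionSepRanks⇒κ≤1+k : ∀ {k X} → X ⊆ E M →
              VerticalSepRanks (r M X) (r M (compl (M ∖ e) X)) (rM (M ∖ e)) k → κ M ≤ suc k
  deletionSepRanks⇒κ≤1+k {k} {X} X⊆E sepRanks with deletion-sepRanks
      (r[p]≤r[p∪⁅x⁆] M X⊆E e∈E) (r[p∪⁅x⁆]≤1+r[p] M X⊆E e∈E)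
      (r[compl∖]≤r[compl] X) (r[compl]≤1+r[compl∖] X)
      (r[p-x]≤r[p] M e ⊆-refl) (r[p]≤1+r[p-x] M ⊆-refl e∈E)
      sepRanks
  ... | inj₂ R≤1+k = ≤-trans (κ≤rM M) R≤1+k
  ... | inj₁ (j , j≤1+k , inj₁ ranks) = ≤-trans (hasVerticalSep⇒κ≤ M (X ∪ ⁅ e ⁆ , sep)) j≤1+k
    where
    sep : IsVerticalSep M j (X ∪ ⁅ e ⁆)
    sep = sepRanks⇒isVerticalSep M (∪-least X⊆E (x∈p⇒⁅x⁆⊆p e∈E))
      (subst (λ Y → VerticalSepRanks (r M (X ∪ ⁅ e ⁆)) (r M Y) (rM M) j)
        (sym (compl[X∪⁅e⁆]≡compl∖ X)) ranks)
  ... | inj₁ (j , j≤1+k , inj₂ ranks) =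
    ≤-trans (hasVerticalSep⇒κ≤ M (X , sepRanks⇒isVerticalSep M X⊆E ranks)) j≤1+k

  κ≤1+κ[M∖e] : κ M ≤ suc (κ (M ∖ e))
  κ≤1+κ[M∖e] with κ≡rM⊎sep (M ∖ e)
  ... | inj₂ (X , X⊆E⁻ , sep) =
    deletionSepRanks⇒κ≤1+k (⊆-trans X⊆E⁻ (p─q⊆p (E M) ⁅ e ⁆))
      (isVerticalSep⇒sepRanks (M ∖ e) (X⊆E⁻ , sep))
  ... | inj₁ κ≡R⁻ =
    subst (λ k → κ M ≤ suc k) (sym κ≡R⁻) (≤-trans (κ≤rM M) (r[p]≤1+r[p-x] M ⊆-refl e∈E))

lemma2p1 : ∀ {n : ℕ} (M : Matroid n) → 2 ≤ ∣ E M ∣ → (e : Fin n) → e ∈ E M →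
    κ M ∸ 1 ≤ κ (M ∖ e)
lemma2p1 M _ e e∈E = ∸-monoˡ-≤ 1 (κ≤1+κ[M∖e] M e∈E)
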